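{- If $\mathbf{y}=(y_1,y_2)\in\mathbb{N}^2$, then $\mathsf{PS}_2(\mathbf{y})=\mathsf{PA}_2(\mathbf{y})$.
   Context: For $\mathbf{y}=(y_1,\ldots,y_n)\in\mathbb{N}^n$ (car lengths), let $m=\sum_i y_i$ be the number of spots $1,\ldots,m$ on a one-way street, and let $\mathbf{x}=(x_1,\ldots,x_n)\in[m]^n$ be a preference list; cars enter in order $1,\ldots,n$. Parking sequence rule: car $i$ finds the first empty spot $j\ge x_i$; if spots $j,\ldots,j+y_i-1$ are all empty it parks there, otherwise it fails to park. $\mathsf{PS}_n(\mathbf{y})$ is the set of $\mathbf{x}$ for which all cars park. Parking assortment rule: car $i$ parks in spots $x_i,\ldots,x_i+y_i-1$ if these are unoccupied; otherwise it proceeds down the street and parks in the first (leftmost) block of $y_i$ contiguous unoccupied spots starting after $x_i$; if none exists, parking fails. $\mathsf{PA}_n(\mathbf{y})$ is the set of $\mathbf{x}$ for which all cars park under this rule. -}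

module Defs where

open import Data.Nat using (ℕ; zero; suc; _+_; _≤_)
open import Data.Bool using (Bool; true; false; not; _∧_; if_then_else_)
open import Data.List using (List; []; _∷_)
open import Data.Maybe using (Maybe; just; nothing; Is-just)
open import Data.Product using (_×_; _,_)
open import Data.Vec using (Vec; []; _∷_; toList; foldr)
open import Data.Vec.Relation.Unary.All using (All)

-- A street with m spots is a list of m Booleans; entry k (0-based) is spot k+1,
-- true = occupied.

emptyAt : List Bool → ℕ → Bool
emptyAt [] _ = false
emptyAt (b ∷ bs) zero = false
emptyAt (b ∷ bs) (suc zero) = not b
emptyAt (b ∷ bs) (suc (suc k)) = emptyAt bs (suc k)

blockFree : List Bool → ℕ → ℕ → Bool
blockFree occ j zero = true
blockFree occ j (suc y) = emptyAt occ j ∧ blockFree occ (suc j) y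

occupy1 : List Bool → ℕ → List Bool
occupy1 [] _ = []
occupy1 (b ∷ bs) zero = b ∷ bs
occupy1 (b ∷ bs) (suc zero) = true ∷ bs
occupy1 (b ∷ bs) (suc (suc k)) = b ∷ occupy1 bs (suc k)

occupy : List Bool → ℕ → ℕ → List Bool
occupy occ j zero = occ
occupy occ j (suc y) = occupy (occupy1 occ j) (suc j) y

search : (ℕ → Bool) → ℕ → ℕ → Maybe ℕ
search p s zero = nothing
search p s (suc f) = if p s then just s else search p (suc s) f

streetLen : List Bool → ℕ
streetLen [] = 0
streetLen (_ ∷ bs) = suc (streetLen bs)

psStep : List Bool → ℕ → ℕ → Maybe (List Bool)
psStep occ x y with search (emptyAt occ) x (streetLen occ)
... | nothing = nothing
... | just j = if blockFree occ j y then just (occupy occ j y) else nothing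

paStep : List Bool → ℕ → ℕ → Maybe (List Bool)
paStep occ x y with blockFree occ x y
... | true = just (occupy occ x y)
... | false with search (λ j → blockFree occ j y) (suc x) (streetLen occ)
...   | nothing = nothing
...   | just j = just (occupy occ j y)

-- Run cars in order; each car is (preference , length).
run : (List Bool → ℕ → ℕ → Maybe (List Bool)) → List (ℕ × ℕ) → List Bool → Maybe (List Bool)
run step [] occ = just occ
run step ((x , y) ∷ cs) occ with step occ x y
... | nothing = nothing
... | just occ' = run step cs occ'

emptyStreet : ℕ → List Bool
emptyStreet zero = []
emptyStreet (suc m) = false ∷ emptyStreet m

zipV : ∀ {n} → Vec ℕ n → Vec ℕ n → List (ℕ × ℕ)
zipV [] [] = []
zipV (a ∷ as) (b ∷ bs) = (a , b) ∷ zipV as bs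

total : ∀ {n} → Vec ℕ n → ℕ
total = foldr (λ _ → ℕ) _+_ 0

InRange : ℕ → ∀ {n} → Vec ℕ n → Set
InRange m x = All (λ xi → 1 ≤ xi × xi ≤ m) x

_∈PS_ : ∀ {n} → Vec ℕ n → Vec ℕ n → Set
x ∈PS y = InRange (total y) x × Is-just (run psStep (zipV x y) (emptyStreet (total y)))

_∈PA_ : ∀ {n} → Vec ℕ n → Vec ℕ n → Set
x ∈PA y = InRange (total y) x × Is-just (run paStep (zipV x y) (emptyStreet (total y)))

-- Under either rule a car parks in some free block starting at or after its
-- preference, and when the first empty spot past the preference begins a free
-- block of the right length both rules choose that block; hence every parking
-- sequence is a parking assortment.  Conversely, on the empty street the first
-- car parks at its preference under both rules, leaving free stretches of
-- lengths a and c on either side of it with a + c = y₂.  A free block of length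
-- y₂ must then use every free spot, so no empty spot precedes it and the parking
-- sequence rule finds it as well.
module Submission where

open import Defs
open import Data.Bool using (Bool; true; false; not)
open import Data.Bool.Properties using (not-¬; ¬-not)
open import Data.Empty using (⊥-elim)
open import Data.List using (List; []; _∷_; _++_; replicate; length)
open import Data.List.Properties using (++-assoc; ++-identityʳ; length-++; length-replicate)
open import Data.List.Relation.Unary.All using (All; []; _∷_)
open import Data.Maybe using (just; Is-just)
open import Data.Maybe.Properties using (just-injective)
open import Data.Maybe.Relation.Unary.Any using (just)
open import Data.Nat using (ℕ; zero; suc; _+_; _≤_; _<_; z≤n; s≤s; z<s; _<?_)
open import Data.Nat.Properties
open import Data.Product using (∃-syntax; ∃₂; _×_; _,_; proj₁; proj₂)
open import Data.Sum using (_⊎_; inj₁; inj₂)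
open import Data.Unit using (tt)
open import Data.Vec using (Vec; _∷_; [])
open import Data.Vec.Relation.Unary.All using (_∷_; [])
open import Function using (_∘_)
open import Function.Bundles using (_⇔_; mk⇔)
open import Relation.Nullary using (yes; no)
open import Relation.Binary.PropositionalEquality

record Least (p : ℕ → Bool) (s j : ℕ) : Set where
  field
    from   : s ≤ j
    holds  : p j ≡ true
    before : ∀ {k} → s ≤ k → k < j → p k ≡ false

open Least

least-here : ∀ {p s} → p s ≡ true → Least p s s
least-here ps = record
  { from = ≤-refl ; holds = ps ; before = λ s≤k k<s → ⊥-elim (<⇒≱ k<s s≤k) }

least-suc⇒least : ∀ {p s j} → p s ≡ false → Least p (suc s) j → Least p s j
least-suc⇒least {p} {s} {j} ps l = record
  { from = <⇒≤ (from l) ; holds = holds l ; before = before′ }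
  where
  before′ : ∀ {k} → s ≤ k → k < j → p k ≡ false
  before′ s≤k k<j with m≤n⇒m<n∨m≡n s≤k
  ... | inj₁ s<k  = before l s<k k<j
  ... | inj₂ refl = ps

least⇒least-suc : ∀ {p s j} → p s ≡ false → Least p s j → Least p (suc s) j
least⇒least-suc {p} {s} {j} ps l = record
  { from = ≤∧≢⇒< (from l) s≢j ; holds = holds l ; before = before l ∘ <⇒≤ }
  where
  s≢j : s ≢ j
  s≢j refl = not-¬ (holds l) ps

search-sound : ∀ p s f {j} → search p s f ≡ just j → Least p s j × j < s + f
search-sound p s (suc f) eq with p s in ps
search-sound p s (suc f) refl | true = least-here ps , m<m+n s z<s
search-sound p s (suc f) {j} eq | false with search-sound p (suc s) f eq
... | l , j<1+s+f = least-suc⇒least ps l , subst (j <_) (sym (+-suc s f)) j<1+s+f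

search-complete : ∀ p s f {j} → Least p s j → j < s + f → search p s f ≡ just j
search-complete p s zero {j} l j<s = ⊥-elim (<⇒≱ (subst (j <_) (+-identityʳ s) j<s) (from l))
search-complete p s (suc f) {j} l j<s+f with p s in ps
... | false = search-complete p (suc s) f (least⇒least-suc ps l) (subst (j <_) (+-suc s f) j<s+f)
... | true with m≤n⇒m<n∨m≡n (from l)
...   | inj₁ s<j  = ⊥-elim (not-¬ ps (before l ≤-refl s<j))
...   | inj₂ refl = refl

emptyAt⇒inStreet : ∀ occ j → emptyAt occ j ≡ true → 1 ≤ j × j ≤ streetLen occ
emptyAt⇒inStreet (b ∷ bs) (suc zero)    e = s≤s z≤n , s≤s z≤n
emptyAt⇒inStreet (b ∷ bs) (suc (suc k)) e =
  s≤s z≤n , s≤s (proj₂ (emptyAt⇒inStreet bs (suc k) e))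

streetLen≡length : ∀ occ → streetLen occ ≡ length occ
streetLen≡length []       = refl
streetLen≡length (_ ∷ bs) = cong suc (streetLen≡length bs)

blockFree-head : ∀ occ j y → 1 ≤ y → blockFree occ j y ≡ true → emptyAt occ j ≡ true
blockFree-head occ j (suc y) _ free with emptyAt occ j
... | true = refl

blockFree-occupiedHead : ∀ occ j y → 1 ≤ y → emptyAt occ j ≡ false → blockFree occ j y ≡ false
blockFree-occupiedHead occ j (suc y) _ e rewrite e = refl

blockFree⇒emptyAt : ∀ occ j y → blockFree occ j y ≡ true →
  ∀ {i} → i < y → emptyAt occ (j + i) ≡ true
blockFree⇒emptyAt occ j (suc y) free {i} i<y with emptyAt occ j in e
blockFree⇒emptyAt occ j (suc y) free {zero}  _          | true =
  subst (λ t → emptyAt occ t ≡ true) (sym (+-identityʳ j)) e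
blockFree⇒emptyAt occ j (suc y) free {suc i} (s≤s i<y) | true =
  subst (λ t → emptyAt occ t ≡ true) (sym (+-suc j i)) (blockFree⇒emptyAt occ (suc j) y free i<y)

emptyAt⇒blockFree : ∀ occ j y → (∀ {i} → i < y → emptyAt occ (j + i) ≡ true) →
  blockFree occ j y ≡ true
emptyAt⇒blockFree occ j zero    free = refl
emptyAt⇒blockFree occ j (suc y) free
  rewrite subst (λ t → emptyAt occ t ≡ true) (+-identityʳ j) (free z<s) =
  emptyAt⇒blockFree occ (suc j) y
    (λ i<y → subst (λ t → emptyAt occ t ≡ true) (+-suc j _) (free (s≤s i<y)))

blockFree⇒inStreet : ∀ occ p y → 1 ≤ y → blockFree occ p y ≡ true → p + y ≤ suc (streetLen occ)
blockFree⇒inStreet occ p (suc y) _ free =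
  subst (_≤ suc (streetLen occ)) (sym (+-suc p y))
    (s≤s (proj₂ (emptyAt⇒inStreet occ (p + y) last-empty)))
  where
  last-empty : emptyAt occ (p + y) ≡ true
  last-empty = blockFree⇒emptyAt occ p (suc y) free ≤-refl

blockFree-avoids : ∀ occ p y {s} → blockFree occ p y ≡ true → emptyAt occ s ≡ false →
  s < p ⊎ p + y ≤ s
blockFree-avoids occ p y {s} free taken with s <? p
... | yes s<p = inj₁ s<p
... | no s≮p with m≤n⇒∃[o]m+o≡n (≮⇒≥ s≮p)
...   | i , refl with i <? y
...     | yes i<y = ⊥-elim (not-¬ (blockFree⇒emptyAt occ p y free i<y) taken)
...     | no i≮y  = inj₂ (+-monoʳ-≤ p (≮⇒≥ i≮y))

paStep-here : ∀ occ x y → blockFree occ x y ≡ true → paStep occ x y ≡ just (occupy occ x y)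
paStep-here occ x y free rewrite free = refl

paStep-later : ∀ occ x y {j} → blockFree occ x y ≡ false →
  search (λ k → blockFree occ k y) (suc x) (streetLen occ) ≡ just j →
  paStep occ x y ≡ just (occupy occ j y)
paStep-later occ x y taken found rewrite taken | found = refl

paStep-parks : ∀ occ x y {o} → paStep occ x y ≡ just o →
  ∃[ p ] x ≤ p × blockFree occ p y ≡ true × o ≡ occupy occ p y
paStep-parks occ x y pa with blockFree occ x y in free
paStep-parks occ x y refl | true = x , ≤-refl , free , refl
paStep-parks occ x y pa   | false
  with search (λ k → blockFree occ k y) (suc x) (streetLen occ) in found
paStep-parks occ x y refl | false | just j =
  let l , _ = search-sound (λ k → blockFree occ k y) (suc x) (streetLen occ) found
  in j , <⇒≤ (from l) , holds l , refl

psStep-at : ∀ occ x y {p} → search (emptyAt occ) x (streetLen occ) ≡ just p →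
  blockFree occ p y ≡ true → psStep occ x y ≡ just (occupy occ p y)
psStep-at occ x y found free rewrite found | free = refl

psStep-parks : ∀ occ {x y p} → 1 ≤ x → 1 ≤ y → x ≤ p → blockFree occ p y ≡ true →
  (∀ {k} → x ≤ k → k < p → emptyAt occ k ≡ false) → psStep occ x y ≡ just (occupy occ p y)
psStep-parks occ {x} {y} {p} x≥1 y≥1 x≤p free gap = psStep-at occ x y found free
  where
  p-empty : emptyAt occ p ≡ true
  p-empty = blockFree-head occ p y y≥1 free
  found : search (emptyAt occ) x (streetLen occ) ≡ just p
  found = search-complete (emptyAt occ) x (streetLen occ)
    (record { from = x≤p ; holds = p-empty ; before = gap })
    (+-mono-≤ x≥1 (proj₂ (emptyAt⇒inStreet occ p p-empty)))

psStep-parks⁻ : ∀ occ x y {o} → psStep occ x y ≡ just o →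
  ∃[ j ] Least (emptyAt occ) x j × j < x + streetLen occ ×
         blockFree occ j y ≡ true × o ≡ occupy occ j y
psStep-parks⁻ occ x y ps with search (emptyAt occ) x (streetLen occ) in found
... | just j with blockFree occ j y in free
psStep-parks⁻ occ x y refl | just j | true =
  let l , bound = search-sound (emptyAt occ) x (streetLen occ) found
  in j , l , bound , free , refl

psStep⇒paStep : ∀ occ x {y o} → 1 ≤ y → psStep occ x y ≡ just o → paStep occ x y ≡ just o
psStep⇒paStep occ x {y} y≥1 ps with psStep-parks⁻ occ x y ps
... | j , l , bound , free , refl with m≤n⇒m<n∨m≡n (from l)
...   | inj₂ refl = paStep-here occ x y free
...   | inj₁ x<j  =
  paStep-later occ x y (blockFree-occupiedHead occ x y y≥1 (before l ≤-refl x<j))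
    (search-complete (λ k → blockFree occ k y) (suc x) (streetLen occ) first (m<n⇒m<1+n bound))
  where
  first : Least (λ k → blockFree occ k y) (suc x) j
  first = record
    { from   = x<j
    ; holds  = free
    ; before = λ x<k k<j → blockFree-occupiedHead occ _ y y≥1 (before l (<⇒≤ x<k) k<j)
    }

run-just : ∀ step x y cs occ {o} → step occ x y ≡ just o →
  run step ((x , y) ∷ cs) occ ≡ run step cs o
run-just step x y cs occ e rewrite e = refl

run-∷⁻ : ∀ step x y cs occ → Is-just (run step ((x , y) ∷ cs) occ) →
  ∃[ o ] step occ x y ≡ just o × Is-just (run step cs o)
run-∷⁻ step x y cs occ parked with step occ x y
... | just o = o , refl , parked

run-psStep⇒paStep : ∀ cs occ → All (λ c → 1 ≤ proj₂ c) cs →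
  Is-just (run psStep cs occ) → Is-just (run paStep cs occ)
run-psStep⇒paStep []             occ []            parked = parked
run-psStep⇒paStep ((x , y) ∷ cs) occ (y≥1 ∷ y≥1s) parked
  with run-∷⁻ psStep x y cs occ parked
... | o , ps , parked′ =
  subst Is-just (sym (run-just paStep x y cs occ (psStep⇒paStep occ x y≥1 ps)))
    (run-psStep⇒paStep cs o y≥1s parked′)

vacant filled : ℕ → List Bool
vacant n = replicate n false
filled n = replicate n true

emptyStreet≡vacant : ∀ m → emptyStreet m ≡ vacant m
emptyStreet≡vacant zero    = refl
emptyStreet≡vacant (suc m) = cong (false ∷_) (emptyStreet≡vacant m)

replicate-++ : ∀ {A : Set} m n {v : A} → replicate (m + n) v ≡ replicate m v ++ replicate n v
replicate-++ zero    n = refl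
replicate-++ (suc m) n = cong (_ ∷_) (replicate-++ m n)

emptyAt-replicate-++ : ∀ n v ys i →
  emptyAt (replicate n v ++ ys) (suc (n + i)) ≡ emptyAt ys (suc i)
emptyAt-replicate-++ zero    v ys i = refl
emptyAt-replicate-++ (suc n) v ys i = emptyAt-replicate-++ n v ys i

emptyAt-replicate-++ˡ : ∀ n v ys {i} → i < n → emptyAt (replicate n v ++ ys) (suc i) ≡ not v
emptyAt-replicate-++ˡ (suc n) v ys {zero}  _         = refl
emptyAt-replicate-++ˡ (suc n) v ys {suc i} (s≤s i<n) = emptyAt-replicate-++ˡ n v ys i<n

emptyAt-replicate : ∀ n v {i} → i < n → emptyAt (replicate n v) (suc i) ≡ not v
emptyAt-replicate n v i<n =
  subst (λ xs → emptyAt xs _ ≡ not v) (++-identityʳ (replicate n v))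
    (emptyAt-replicate-++ˡ n v [] i<n)

occupy1-++ : ∀ xs b ys → occupy1 (xs ++ b ∷ ys) (suc (length xs)) ≡ xs ++ true ∷ ys
occupy1-++ []       b ys = refl
occupy1-++ (x ∷ xs) b ys = cong (x ∷_) (occupy1-++ xs b ys)

occupy-++ : ∀ xs d ys → occupy (xs ++ vacant d ++ ys) (suc (length xs)) d ≡ xs ++ filled d ++ ys
occupy-++ xs zero    ys = refl
occupy-++ xs (suc d) ys = begin
  occupy (occupy1 (xs ++ false ∷ vacant d ++ ys) (suc (length xs))) (suc (suc (length xs))) d
    ≡⟨ cong (λ zs → occupy zs (suc (suc (length xs))) d) (occupy1-++ xs false (vacant d ++ ys)) ⟩
  occupy (xs ++ true ∷ vacant d ++ ys) (suc (suc (length xs))) d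
    ≡⟨ cong₂ (λ zs n → occupy zs (suc n) d)
             (sym (++-assoc xs (true ∷ []) (vacant d ++ ys))) (sym length-xs∷ʳ) ⟩
  occupy ((xs ++ true ∷ []) ++ vacant d ++ ys) (suc (length (xs ++ true ∷ []))) d
    ≡⟨ occupy-++ (xs ++ true ∷ []) d ys ⟩
  (xs ++ true ∷ []) ++ filled d ++ ys
    ≡⟨ ++-assoc xs (true ∷ []) (filled d ++ ys) ⟩
  xs ++ filled (suc d) ++ ys ∎
  where
  open ≡-Reasoning
  length-xs∷ʳ : length (xs ++ true ∷ []) ≡ suc (length xs)
  length-xs∷ʳ = trans (length-++ xs) (+-comm (length xs) 1)

occupy-vacant : ∀ a y c → occupy (vacant (a + y + c)) (suc a) y ≡ vacant a ++ filled y ++ vacant c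
occupy-vacant a y c = begin
  occupy (vacant (a + y + c)) (suc a) y
    ≡⟨ cong (λ zs → occupy zs (suc a) y)
            (trans (replicate-++ (a + y) c) (cong (_++ vacant c) (replicate-++ a y))) ⟩
  occupy ((vacant a ++ vacant y) ++ vacant c) (suc a) y
    ≡⟨ cong₂ (λ zs n → occupy zs (suc n) y)
             (++-assoc (vacant a) (vacant y) (vacant c)) (sym (length-replicate a)) ⟩
  occupy (vacant a ++ vacant y ++ vacant c) (suc (length (vacant a))) y
    ≡⟨ occupy-++ (vacant a) y (vacant c) ⟩
  vacant a ++ filled y ++ vacant c ∎
  where open ≡-Reasoning

vacant-blockFree : ∀ m a y → a + y ≤ m → blockFree (vacant m) (suc a) y ≡ true
vacant-blockFree m a y a+y≤m =
  emptyAt⇒blockFree (vacant m) (suc a) y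
    (λ i<y → emptyAt-replicate m false (≤-trans (+-monoʳ-< a i<y) a+y≤m))

-- On the empty street a block that fits anywhere past x already fits at x.
paStep-vacant : ∀ m x y {o} → 1 ≤ x → 1 ≤ y → paStep (vacant m) x y ≡ just o →
  psStep (vacant m) x y ≡ just o × ∃₂ λ a c → a + y + c ≡ m × o ≡ vacant a ++ filled y ++ vacant c
paStep-vacant m (suc a) y {o} x≥1 y≥1 pa with paStep-parks (vacant m) (suc a) y pa
... | p , x≤p , p-free , _ = ps , a , c , a+y+c≡m , shape
  where
  p+y≤1+m : p + y ≤ suc m
  p+y≤1+m = subst (λ n → p + y ≤ suc n) (trans (streetLen≡length (vacant m)) (length-replicate m))
    (blockFree⇒inStreet (vacant m) p y y≥1 p-free)
  a+y≤m : a + y ≤ m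
  a+y≤m = ≤-pred (≤-trans (+-monoˡ-≤ y x≤p) p+y≤1+m)
  x-free : blockFree (vacant m) (suc a) y ≡ true
  x-free = vacant-blockFree m a y a+y≤m
  o≡ : o ≡ occupy (vacant m) (suc a) y
  o≡ = just-injective (trans (sym pa) (paStep-here (vacant m) (suc a) y x-free))
  ps : psStep (vacant m) (suc a) y ≡ just o
  ps = trans (psStep-parks (vacant m) x≥1 y≥1 ≤-refl x-free (λ x≤k k<x → ⊥-elim (<⇒≱ k<x x≤k)))
             (cong just (sym o≡))
  c = proj₁ (m≤n⇒∃[o]m+o≡n a+y≤m)
  a+y+c≡m : a + y + c ≡ m
  a+y+c≡m = proj₂ (m≤n⇒∃[o]m+o≡n a+y≤m)
  shape : o ≡ vacant a ++ filled y ++ vacant c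
  shape = trans o≡ (subst (λ n → occupy (vacant n) (suc a) y ≡ vacant a ++ filled y ++ vacant c)
                          a+y+c≡m (occupy-vacant a y c))

emptyAt-split : ∀ a b c {k} → emptyAt (vacant a ++ filled b ++ vacant c) k ≡ true →
  k ≤ a ⊎ a + b < k
emptyAt-split a b c {zero}  _ = inj₁ z≤n
emptyAt-split a b c {suc i} e with i <? a
... | yes i<a = inj₁ i<a
... | no i≮a with m≤n⇒∃[o]m+o≡n (≮⇒≥ i≮a)
...   | j , refl with j <? b
...     | no j≮b  = inj₂ (s≤s (+-monoʳ-≤ a (≮⇒≥ j≮b)))
...     | yes j<b =
  ⊥-elim (not-¬ e (trans (emptyAt-replicate-++ a false _ j) (emptyAt-replicate-++ˡ b true _ j<b)))

emptyAt-gap : ∀ a {b} c → 1 ≤ b → emptyAt (vacant a ++ filled b ++ vacant c) (suc a) ≡ false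
emptyAt-gap zero    c (s≤s z≤n) = refl
emptyAt-gap (suc a) c b≥1       = emptyAt-gap a c b≥1

streetLen-split : ∀ a b c → streetLen (vacant a ++ filled b ++ vacant c) ≡ a + (b + c)
streetLen-split a b c = begin
  streetLen (vacant a ++ filled b ++ vacant c)       ≡⟨ streetLen≡length _ ⟩
  length (vacant a ++ filled b ++ vacant c)          ≡⟨ length-++ (vacant a) ⟩
  length (vacant a) + length (filled b ++ vacant c)  ≡⟨ cong (length (vacant a) +_) (length-++ (filled b)) ⟩
  length (vacant a) + (length (filled b) + length (vacant c))
    ≡⟨ cong₂ _+_ (length-replicate a) (cong₂ _+_ (length-replicate b) (length-replicate c)) ⟩
  a + (b + c) ∎
  where open ≡-Reasoning

-- The block has as many spots as the street has free ones, so it cannot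
-- leave a free spot to its left.
emptyAt-before-block : ∀ a b c {p k} → 1 ≤ b → 1 ≤ a + c →
  blockFree (vacant a ++ filled b ++ vacant c) p (a + c) ≡ true → k < p →
  emptyAt (vacant a ++ filled b ++ vacant c) k ≡ false
emptyAt-before-block a b c {p} {k} b≥1 y≥1 free k<p = ¬-not k-taken
  where
  L = vacant a ++ filled b ++ vacant c
  p+y≤ : p + (a + c) ≤ suc (a + b) + c
  p+y≤ = subst (p + (a + c) ≤_) (cong suc (trans (streetLen-split a b c) (sym (+-assoc a b c))))
    (blockFree⇒inStreet L p (a + c) y≥1 free)
  k-taken : emptyAt L k ≢ true
  k-taken k-free with blockFree-avoids L p (a + c) free (emptyAt-gap a c b≥1)
  ... | inj₂ p+y≤1+a = 1+n≰n (≤-trans (+-mono-≤ 2≤p (m≤m+n a c)) p+y≤1+a)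
    where
    2≤p : 2 ≤ p
    2≤p = ≤-trans (s≤s (proj₁ (emptyAt⇒inStreet L k k-free))) k<p
  ... | inj₁ 1+a<p with emptyAt-split a b c (blockFree-head L p (a + c) y≥1 free)
  ...   | inj₁ p≤a   = <⇒≱ 1+a<p (m≤n⇒m≤1+n p≤a)
  ...   | inj₂ a+b<p with emptyAt-split a b c k-free
  ...     | inj₁ k≤a   = <⇒≱ (proj₁ (emptyAt⇒inStreet L k k-free)) (subst (k ≤_) a≡0 k≤a)
    where
    a+c≤c : a + c ≤ c
    a+c≤c = +-cancelˡ-≤ (suc (a + b)) _ _ (≤-trans (+-monoˡ-≤ (a + c) a+b<p) p+y≤)
    a≡0 : a ≡ 0
    a≡0 = n≤0⇒n≡0 (+-cancelʳ-≤ c a 0 a+c≤c)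
  ...     | inj₂ a+b<k = <⇒≱ (≤-<-trans a+b<k k<p) p≤1+a+b
    where
    p≤1+a+b : p ≤ suc (a + b)
    p≤1+a+b = +-cancelʳ-≤ (a + c) p (suc (a + b))
      (≤-trans p+y≤ (+-monoʳ-≤ (suc (a + b)) (m≤n+m c a)))

paStep⇒psStep-beside : ∀ a b c x {y o} → a + c ≡ y → 1 ≤ b → 1 ≤ x → 1 ≤ y →
  paStep (vacant a ++ filled b ++ vacant c) x y ≡ just o →
  psStep (vacant a ++ filled b ++ vacant c) x y ≡ just o
paStep⇒psStep-beside a b c x refl b≥1 x≥1 y≥1 pa with paStep-parks _ x (a + c) pa
... | p , x≤p , free , refl =
  psStep-parks _ x≥1 y≥1 x≤p free (λ _ k<p → emptyAt-before-block a b c b≥1 y≥1 free k<p)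

run₂-paStep⇒psStep : ∀ x₁ y₁ x₂ y₂ → 1 ≤ x₁ → 1 ≤ x₂ → 1 ≤ y₁ → 1 ≤ y₂ →
  Is-just (run paStep ((x₁ , y₁) ∷ (x₂ , y₂) ∷ []) (vacant (y₁ + y₂))) →
  Is-just (run psStep ((x₁ , y₁) ∷ (x₂ , y₂) ∷ []) (vacant (y₁ + y₂)))
run₂-paStep⇒psStep x₁ y₁ x₂ y₂ x₁≥1 x₂≥1 y₁≥1 y₂≥1 parked
  with run-∷⁻ paStep x₁ y₁ _ _ parked
... | o₁ , pa₁ , parked₁ with run-∷⁻ paStep x₂ y₂ [] o₁ parked₁
... | o₂ , pa₂ , _ with paStep-vacant (y₁ + y₂) x₁ y₁ x₁≥1 y₁≥1 pa₁
... | ps₁ , a , c , a+y₁+c≡y₁+y₂ , refl =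
  subst Is-just
    (sym (trans (run-just psStep x₁ y₁ _ (vacant (y₁ + y₂)) ps₁) (run-just psStep x₂ y₂ [] street₁ ps₂)))
    (just tt)
  where
  street₁ : List Bool
  street₁ = vacant a ++ filled y₁ ++ vacant c
  a+c≡y₂ : a + c ≡ y₂
  a+c≡y₂ = +-cancelˡ-≡ y₁ (a + c) y₂ (begin
    y₁ + (a + c) ≡⟨ sym (+-assoc y₁ a c) ⟩
    y₁ + a + c   ≡⟨ cong (_+ c) (+-comm y₁ a) ⟩
    a + y₁ + c   ≡⟨ a+y₁+c≡y₁+y₂ ⟩
    y₁ + y₂      ∎)
    where open ≡-Reasoning
  ps₂ : psStep street₁ x₂ y₂ ≡ just o₂
  ps₂ = paStep⇒psStep-beside a y₁ c x₂ a+c≡y₂ y₁≥1 x₂≥1 y₂≥1 pa₂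

lemma3p1 : (y₁ y₂ : ℕ) → 1 ≤ y₁ → 1 ≤ y₂ →
    (x : Vec ℕ 2) → (x ∈PS (y₁ ∷ y₂ ∷ [])) ⇔ (x ∈PA (y₁ ∷ y₂ ∷ []))
lemma3p1 y₁ y₂ y₁≥1 y₂≥1 (x₁ ∷ x₂ ∷ []) = mk⇔ ps⇒pa pa⇒ps
  where
  cars : List (ℕ × ℕ)
  cars = (x₁ , y₁) ∷ (x₂ , y₂) ∷ []

  street≡ : emptyStreet (y₁ + (y₂ + 0)) ≡ vacant (y₁ + y₂)
  street≡ = trans (emptyStreet≡vacant _) (cong (λ n → vacant (y₁ + n)) (+-identityʳ y₂))

  ps⇒pa : (x₁ ∷ x₂ ∷ []) ∈PS (y₁ ∷ y₂ ∷ []) → (x₁ ∷ x₂ ∷ []) ∈PA (y₁ ∷ y₂ ∷ [])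
  ps⇒pa (range , parked) = range , run-psStep⇒paStep cars _ (y₁≥1 ∷ y₂≥1 ∷ []) parked

  pa⇒ps : (x₁ ∷ x₂ ∷ []) ∈PA (y₁ ∷ y₂ ∷ []) → (x₁ ∷ x₂ ∷ []) ∈PS (y₁ ∷ y₂ ∷ [])
  pa⇒ps (range@((x₁≥1 , _) ∷ (x₂≥1 , _) ∷ []) , parked) = range ,
    subst (Is-just ∘ run psStep cars) (sym street≡)
      (run₂-paStep⇒psStep x₁ y₁ x₂ y₂ x₁≥1 x₂≥1 y₁≥1 y₂≥1
        (subst (Is-just ∘ run paStep cars) street≡ parked))
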